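{- Let $q=2^m$ with $m\ge 1$, let $E=\mathbb{F}_{q^4}$, and let $\mathcal{P}=\{x\in E \mid x^{q^3+q^2+q+1}=1\}$. Let $\beta\in\mathcal{P}$ and $\alpha\in E$ satisfy $\alpha^{q+1}=\beta^q+\beta^{q^2+q+1}$. If $\alpha\neq 0$, then $\alpha^{q^2-1}\beta^{q+1}=1$. -}

module Defs where

open import Level using (Level; _⊔_)
open import Data.Nat using (ℕ)
open import Data.Fin using (Fin)
open import Data.Product using (∃)
open import Relation.Nullary using (¬_)
open import Relation.Binary.PropositionalEquality using (setoid)
open import Algebra.Bundles using (CommutativeRing; Semiring)
open import Function.Bundles using (Inverse)
import Algebra.Definitions.RawSemiring as RS

record IsField {c ℓ} (R : CommutativeRing c ℓ) : Set (c ⊔ ℓ) where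
  open CommutativeRing R
  field
    1≉0     : ¬ (1# ≈ 0#)
    inverse : ∀ x → ¬ (x ≈ 0#) → ∃ λ y → (x * y) ≈ 1#

HasCardinality : ∀ {c ℓ} (R : CommutativeRing c ℓ) → ℕ → Set (c ⊔ ℓ)
HasCardinality R n = Inverse (CommutativeRing.setoid R) (setoid (Fin n))

pow : ∀ {c ℓ} (R : CommutativeRing c ℓ) → CommutativeRing.Carrier R → ℕ → CommutativeRing.Carrier R
pow R = RS._^_ (Semiring.rawSemiring (CommutativeRing.semiring R))

{-# OPTIONS --safe #-}
module Submission where

open import Defs
open import Data.Nat using (ℕ; zero; suc; _≤_; _∸_; NonZero) renaming (_+_ to _+ℕ_; _*_ to _*ℕ_; _^_ to _^ℕ_)
import Data.Nat.Properties as ℕ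
open import Data.Nat.Solver using (module +-*-Solver)
open import Data.Fin using (Fin)
import Data.Fin.Properties as Fin
open import Data.Product using (_,_)
open import Relation.Nullary using (¬_)
open import Relation.Nullary.Decidable using (decidable-stable)
open import Relation.Binary.PropositionalEquality as ≡ using (_≡_) renaming (setoid to ≡-setoid)
open import Algebra.Bundles using (AbelianGroup; CommutativeRing)
open import Function.Bundles using (Inverse)
open import Function.Properties.Inverse using (Inverse⇒Injection)
import Function.Construct.Composition as Composition
import Function.Construct.Symmetry as Symmetry
import Algebra.Solver.CommutativeMonoid as CommutativeMonoidSolver

-- Write N = β^(q²+1) and γ = 1 + N.  The hypothesis on α says α^(q+1) = β^q γ, so γ ≠ 0, and
-- α^(q²-1) β^(q+1) γ = (β^q γ)^(q-1) β^(q+1) γ = N γ^q.  Since E has characteristic 2, q is a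
-- power of the characteristic, so γ^q = 1 + N^q, and N^(q+1) = β^(q³+q²+q+1) = 1 gives
-- N γ^q = N + 1 = γ.  Cancelling γ yields the claim.  Characteristic 2 itself comes from
-- counting: translation by 1 permutes the 2^(4m) elements of E, so 2^(4m) · 1 = 0.

module _ {a ℓ} (G : AbelianGroup a ℓ) where
  open AbelianGroup G
  open import Algebra.Properties.Group group using (//-rightDividesˡ; //-rightDividesʳ; //-cong₂; identityʳ-unique)
  open import Algebra.Properties.CommutativeMonoid.Sum commutativeMonoid using (sum; sum-permute; sum-cong-≋; ∑-distrib-+; sum-replicate)
  open import Algebra.Properties.Monoid.Mult monoid using (_×_)
  open import Relation.Binary.Reasoning.Setoid setoid

  ∙-translation : Carrier → Inverse setoid setoid
  ∙-translation x = record
    { to        = _∙ x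
    ; from      = _- x
    ; to-cong   = ∙-congʳ
    ; from-cong = λ y≈z → //-cong₂ y≈z refl
    ; inverse   = (λ y≈z-x → trans (∙-congʳ y≈z-x) (//-rightDividesˡ x _))
                , (λ y≈z∙x → trans (//-cong₂ y≈z∙x refl) (//-rightDividesʳ x _))
    }

  -- The sum of all elements is invariant under translation by x.
  card×x≈ε : ∀ {n} → Inverse setoid (≡-setoid (Fin n)) → ∀ x → n × x ≈ ε
  card×x≈ε {n} card x = identityʳ-unique (sum from) (n × x) (sym (begin
    sum from                            ≈⟨ sum-permute from translation ⟩
    sum (λ i → from (to (from i ∙ x)))  ≈⟨ sum-cong-≋ (λ i → strictlyInverseʳ (from i ∙ x)) ⟩
    sum (λ i → from i ∙ x)              ≈⟨ ∑-distrib-+ from (λ _ → x) ⟩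
    sum from ∙ sum {n} (λ _ → x)        ≈⟨ ∙-congˡ (sum-replicate n) ⟩
    sum from ∙ n × x                    ∎))
    where
    open Inverse card using (to; from; strictlyInverseʳ)
    translation = Composition.inverse (Symmetry.inverse card) (Composition.inverse (∙-translation x) card)

module _ {c ℓ} (E : CommutativeRing c ℓ) where
  open CommutativeRing E
  open import Algebra.Properties.Semiring.Exp semiring using (_^_; ^-congˡ; ^-congʳ; ^-homo-*; ^-assocʳ)
  open import Algebra.Properties.CommutativeSemiring.Exp commutativeSemiring using (^-distrib-*)
  open import Algebra.Properties.Semiring.Mult semiring using (_×_; ×1-homo-*)
  open import Algebra.Properties.Monoid.Mult *-monoid using () renaming (×-idem to ^-idem)
  open import Relation.Binary.Reasoning.Setoid setoid
  open +-*-Solver using (solve; _:+_; _:*_; _:^_; con; _:=_)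
  module +-Solver = CommutativeMonoidSolver +-commutativeMonoid
  module *-Solver = CommutativeMonoidSolver *-commutativeMonoid

  ×1-homo-^ : ∀ a k → (a ^ℕ k) × 1# ≈ (a × 1#) ^ k
  ×1-homo-^ a zero    = +-identityʳ 1#
  ×1-homo-^ a (suc k) = trans (×1-homo-* a (a ^ℕ k)) (*-congˡ (×1-homo-^ a k))

  x^[2*n]≈x^n*x^n : ∀ x n → x ^ (2 *ℕ n) ≈ x ^ n * x ^ n
  x^[2*n]≈x^n*x^n x n = trans (^-homo-* x n (n +ℕ 0)) (*-congˡ (^-congʳ x (ℕ.+-identityʳ n)))

  module CharacteristicTwo (1+1≈0 : 1# + 1# ≈ 0#) where

    x+x≈0 : ∀ x → x + x ≈ 0#
    x+x≈0 x = begin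
      x + x              ≈⟨ +-cong (*-identityˡ x) (*-identityˡ x) ⟨
      1# * x + 1# * x    ≈⟨ distribʳ x 1# 1# ⟨
      (1# + 1#) * x      ≈⟨ *-congʳ 1+1≈0 ⟩
      0# * x             ≈⟨ zeroˡ x ⟩
      0#                 ∎

    [x+y]*[x+y]≈x*x+y*y : ∀ x y → (x + y) * (x + y) ≈ x * x + y * y
    [x+y]*[x+y]≈x*x+y*y x y = begin
      (x + y) * (x + y)                  ≈⟨ distribʳ (x + y) x y ⟩
      x * (x + y) + y * (x + y)          ≈⟨ +-cong (distribˡ x x y) (distribˡ y x y) ⟩
      (x * x + x * y) + (y * x + y * y)  ≈⟨ +-congˡ (+-congʳ (*-comm y x)) ⟩
      (x * x + x * y) + (x * y + y * y)  ≈⟨ +-Solver.solve 3 (λ a b c → (a ⊕ b) ⊕ (b ⊕ c) ⊜ (a ⊕ c) ⊕ (b ⊕ b)) refl (x * x) (x * y) (y * y) ⟩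
      (x * x + y * y) + (x * y + x * y)  ≈⟨ +-congˡ (x+x≈0 (x * y)) ⟩
      (x * x + y * y) + 0#               ≈⟨ +-identityʳ _ ⟩
      x * x + y * y                      ∎
      where open +-Solver using (_⊕_; _⊜_)

    ^2^k-distrib-+ : ∀ k x y → (x + y) ^ (2 ^ℕ k) ≈ x ^ (2 ^ℕ k) + y ^ (2 ^ℕ k)
    ^2^k-distrib-+ zero    x y = trans (*-identityʳ (x + y)) (sym (+-cong (*-identityʳ x) (*-identityʳ y)))
    ^2^k-distrib-+ (suc k) x y = begin
      (x + y) ^ (2 *ℕ n)                   ≈⟨ x^[2*n]≈x^n*x^n (x + y) n ⟩
      (x + y) ^ n * (x + y) ^ n            ≈⟨ *-cong (^2^k-distrib-+ k x y) (^2^k-distrib-+ k x y) ⟩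
      (x ^ n + y ^ n) * (x ^ n + y ^ n)    ≈⟨ [x+y]*[x+y]≈x*x+y*y (x ^ n) (y ^ n) ⟩
      x ^ n * x ^ n + y ^ n * y ^ n        ≈⟨ +-cong (x^[2*n]≈x^n*x^n x n) (x^[2*n]≈x^n*x^n y n) ⟨
      x ^ (2 *ℕ n) + y ^ (2 *ℕ n)          ∎
      where n = 2 ^ℕ k

  x^q+x^[q²+q+1]≈x^q*[1+x^[q²+1]] : ∀ q x →
    x ^ q + x ^ (q ^ℕ 2 +ℕ q +ℕ 1) ≈ x ^ q * (1# + x ^ (q ^ℕ 2 +ℕ 1))
  x^q+x^[q²+q+1]≈x^q*[1+x^[q²+1]] q x = begin
    x ^ q + x ^ (q ^ℕ 2 +ℕ q +ℕ 1)        ≈⟨ +-congˡ (^-congʳ x exponent) ⟩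
    x ^ q + x ^ (q +ℕ (q ^ℕ 2 +ℕ 1))      ≈⟨ +-congˡ (^-homo-* x q (q ^ℕ 2 +ℕ 1)) ⟩
    x ^ q + x ^ q * x ^ (q ^ℕ 2 +ℕ 1)     ≈⟨ +-congʳ (*-identityʳ (x ^ q)) ⟨
    x ^ q * 1# + x ^ q * x ^ (q ^ℕ 2 +ℕ 1) ≈⟨ distribˡ (x ^ q) 1# (x ^ (q ^ℕ 2 +ℕ 1)) ⟨
    x ^ q * (1# + x ^ (q ^ℕ 2 +ℕ 1))      ∎
    where
    exponent : q ^ℕ 2 +ℕ q +ℕ 1 ≡ q +ℕ (q ^ℕ 2 +ℕ 1)
    exponent = solve 1 (λ q → q :^ 2 :+ q :+ con 1 := q :+ (q :^ 2 :+ con 1)) ≡.refl q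

  x^[q²∸1]≈[x^[q+1]]^r : ∀ r x → let q = suc r in x ^ (q ^ℕ 2 ∸ 1) ≈ (x ^ (q +ℕ 1)) ^ r
  x^[q²∸1]≈[x^[q+1]]^r r x = trans (^-congʳ x (≡.cong (_∸ 1) exponent)) (sym (^-assocʳ x (suc r +ℕ 1) r))
    where
    exponent : suc r ^ℕ 2 ≡ suc ((suc r +ℕ 1) *ℕ r)
    exponent = solve 1 (λ r → (con 1 :+ r) :^ 2 := con 1 :+ (con 1 :+ r :+ con 1) :* r) ≡.refl r

  [x^[q²+1]]^[1+q]≈x^[q³+q²+q+1] : ∀ q x → (x ^ (q ^ℕ 2 +ℕ 1)) ^ (1 +ℕ q) ≈ x ^ (q ^ℕ 3 +ℕ q ^ℕ 2 +ℕ q +ℕ 1)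
  [x^[q²+1]]^[1+q]≈x^[q³+q²+q+1] q x = trans (^-assocʳ x (q ^ℕ 2 +ℕ 1) (1 +ℕ q)) (^-congʳ x exponent)
    where
    exponent : (q ^ℕ 2 +ℕ 1) *ℕ (1 +ℕ q) ≡ q ^ℕ 3 +ℕ q ^ℕ 2 +ℕ q +ℕ 1
    exponent = solve 1 (λ q → (q :^ 2 :+ con 1) :* (con 1 :+ q) := q :^ 3 :+ q :^ 2 :+ q :+ con 1) ≡.refl q

  [x^q*y]^r*x^[q+1]*y≈x^[q²+1]*y^q : ∀ r x y → let q = suc r in
    (x ^ q * y) ^ r * x ^ (q +ℕ 1) * y ≈ x ^ (q ^ℕ 2 +ℕ 1) * y ^ q
  [x^q*y]^r*x^[q+1]*y≈x^[q²+1]*y^q r x y = begin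
    (x ^ q * y) ^ r * x ^ (q +ℕ 1) * y         ≈⟨ *-congʳ (*-congʳ (^-distrib-* (x ^ q) y r)) ⟩
    (x ^ q) ^ r * y ^ r * x ^ (q +ℕ 1) * y     ≈⟨ *-Solver.solve 4 (λ a b c d → ((a ⊕ b) ⊕ c) ⊕ d ⊜ (a ⊕ c) ⊕ (d ⊕ b)) refl
                                                    ((x ^ q) ^ r) (y ^ r) (x ^ (q +ℕ 1)) y ⟩
    (x ^ q) ^ r * x ^ (q +ℕ 1) * (y * y ^ r)   ≈⟨ *-congʳ (*-congʳ (^-assocʳ x q r)) ⟩
    x ^ (q *ℕ r) * x ^ (q +ℕ 1) * y ^ q        ≈⟨ *-congʳ (^-homo-* x (q *ℕ r) (q +ℕ 1)) ⟨
    x ^ (q *ℕ r +ℕ (q +ℕ 1)) * y ^ q           ≈⟨ *-congʳ (^-congʳ x exponent) ⟩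
    x ^ (q ^ℕ 2 +ℕ 1) * y ^ q                  ∎
    where
    q = suc r
    open *-Solver using (_⊕_; _⊜_)
    exponent : q *ℕ r +ℕ (q +ℕ 1) ≡ q ^ℕ 2 +ℕ 1
    exponent = solve 1 (λ r → (con 1 :+ r) :* r :+ (con 1 :+ r :+ con 1) := (con 1 :+ r) :^ 2 :+ con 1) ≡.refl r

  module _ (F : IsField E) where
    open IsField F

    *-cancelˡ : ∀ {x y z} → ¬ x ≈ 0# → x * y ≈ x * z → y ≈ z
    *-cancelˡ {x} {y} {z} x≉0 xy≈xz with inverse x x≉0
    ... | x⁻¹ , x*x⁻¹≈1 = trans (sym (x⁻¹*[x*w]≈w y)) (trans (*-congˡ xy≈xz) (x⁻¹*[x*w]≈w z))
      where
      x⁻¹*[x*w]≈w : ∀ w → x⁻¹ * (x * w) ≈ w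
      x⁻¹*[x*w]≈w w = begin
        x⁻¹ * (x * w)  ≈⟨ *-assoc x⁻¹ x w ⟨
        x⁻¹ * x * w    ≈⟨ *-congʳ (trans (*-comm x⁻¹ x) x*x⁻¹≈1) ⟩
        1# * w         ≈⟨ *-identityˡ w ⟩
        w              ∎

    x*y≈y⇒x≈1 : ∀ {x y} → ¬ y ≈ 0# → x * y ≈ y → x ≈ 1#
    x*y≈y⇒x≈1 {x} {y} y≉0 xy≈y = *-cancelˡ y≉0 (trans (*-comm y x) (trans xy≈y (sym (*-identityʳ y))))

    x^n≉0 : ∀ {x} → ¬ x ≈ 0# → ∀ n → ¬ x ^ n ≈ 0#
    x^n≉0 x≉0 zero    = 1≉0
    x^n≉0 x≉0 (suc n) x*xⁿ≈0 = x^n≉0 x≉0 n (*-cancelˡ x≉0 (trans x*xⁿ≈0 (sym (zeroʳ _))))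

    -- Equality on a finite carrier is decidable, so refuting p · 1 ≉ 0 suffices.
    card≡p^k⇒p×1≈0 : ∀ p k → HasCardinality E (p ^ℕ k) → p × 1# ≈ 0#
    card≡p^k⇒p×1≈0 p k card = decidable-stable ((p × 1#) ≟ 0#) λ p×1≉0 → x^n≉0 p×1≉0 k (begin
      (p × 1#) ^ k   ≈⟨ ×1-homo-^ p k ⟨
      (p ^ℕ k) × 1#  ≈⟨ card×x≈ε +-abelianGroup card 1# ⟩
      0#             ∎)
      where _≟_ = Fin.inj⇒≟ (Inverse⇒Injection card)

    α^[q²∸1]*β^[q+1]≈1 : ∀ q .{{_ : NonZero q}} → (∀ x y → (x + y) ^ q ≈ x ^ q + y ^ q) →
      ∀ α β → β ^ (q ^ℕ 3 +ℕ q ^ℕ 2 +ℕ q +ℕ 1) ≈ 1# → α ^ (q +ℕ 1) ≈ β ^ q + β ^ (q ^ℕ 2 +ℕ q +ℕ 1) →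
      ¬ α ≈ 0# → α ^ (q ^ℕ 2 ∸ 1) * β ^ (q +ℕ 1) ≈ 1#
    α^[q²∸1]*β^[q+1]≈1 q@(suc r) ^q-distrib-+ α β β^[q³+q²+q+1]≈1 α^[q+1]≈β^q+β^[q²+q+1] α≉0 =
      x*y≈y⇒x≈1 γ≉0 (begin
        α ^ (q ^ℕ 2 ∸ 1) * β ^ (q +ℕ 1) * γ  ≈⟨ *-congʳ (*-congʳ α^[q²∸1]≈[β^q*γ]^r) ⟩
        (β ^ q * γ) ^ r * β ^ (q +ℕ 1) * γ   ≈⟨ [x^q*y]^r*x^[q+1]*y≈x^[q²+1]*y^q r β γ ⟩
        N * γ ^ q                            ≈⟨ *-congˡ (^q-distrib-+ 1# N) ⟩
        N * (1# ^ q + N ^ q)                 ≈⟨ *-congˡ (+-congʳ (^-idem (*-identityʳ 1#) q)) ⟩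
        N * (1# + N ^ q)                     ≈⟨ distribˡ N 1# (N ^ q) ⟩
        N * 1# + N ^ (1 +ℕ q)                ≈⟨ +-cong (*-identityʳ N) N^[1+q]≈1 ⟩
        N + 1#                               ≈⟨ +-comm N 1# ⟩
        γ                                    ∎)
      where
      N = β ^ (q ^ℕ 2 +ℕ 1)
      γ = 1# + N
      α^[q+1]≈β^q*γ : α ^ (q +ℕ 1) ≈ β ^ q * γ
      α^[q+1]≈β^q*γ = trans α^[q+1]≈β^q+β^[q²+q+1] (x^q+x^[q²+q+1]≈x^q*[1+x^[q²+1]] q β)
      γ≉0 : ¬ γ ≈ 0#
      γ≉0 γ≈0 = x^n≉0 α≉0 (q +ℕ 1) (trans α^[q+1]≈β^q*γ (trans (*-congˡ γ≈0) (zeroʳ (β ^ q))))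
      α^[q²∸1]≈[β^q*γ]^r : α ^ (q ^ℕ 2 ∸ 1) ≈ (β ^ q * γ) ^ r
      α^[q²∸1]≈[β^q*γ]^r = trans (x^[q²∸1]≈[x^[q+1]]^r r α) (^-congˡ r α^[q+1]≈β^q*γ)
      N^[1+q]≈1 : N ^ (1 +ℕ q) ≈ 1#
      N^[1+q]≈1 = trans ([x^[q²+1]]^[1+q]≈x^[q³+q²+q+1] q β) β^[q³+q²+q+1]≈1

lemma2p2 : ∀ {c ℓ} (m : ℕ) → 1 ≤ m →
           (E : CommutativeRing c ℓ) → IsField E → HasCardinality E ((2 ^ℕ m) ^ℕ 4) →
           let open CommutativeRing E
               q = 2 ^ℕ m
               _^_ = pow E
           in (α β : Carrier) →
              β ^ (q ^ℕ 3 +ℕ q ^ℕ 2 +ℕ q +ℕ 1) ≈ 1# →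
              α ^ (q +ℕ 1) ≈ (β ^ q) + (β ^ (q ^ℕ 2 +ℕ q +ℕ 1)) →
              ¬ (α ≈ 0#) →
              ((α ^ (q ^ℕ 2 ∸ 1)) * (β ^ (q +ℕ 1))) ≈ 1#
lemma2p2 m _ E F card =
  α^[q²∸1]*β^[q+1]≈1 E F (2 ^ℕ m) {{ℕ.m^n≢0 2 m}} (CharacteristicTwo.^2^k-distrib-+ E 1+1≈0 m)
  where
  open CommutativeRing E
  1+1≈0 : 1# + 1# ≈ 0#
  1+1≈0 = trans (+-congˡ (sym (+-identityʳ 1#)))
                (card≡p^k⇒p×1≈0 E F 2 (m *ℕ 4) (≡.subst (HasCardinality E) (ℕ.^-*-assoc 2 m 4) card))
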